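{- Let $X$ be a finite set and $\mathcal{D}\subseteq\mathcal{R}(X)$. Then $\mathcal{D}$ has the representative voter property if and only if either $\mathcal{D}$ has the single-crossing property, or $\mathcal{D}$ is a closed Condorcet domain with exactly four elements whose associated graph $\Gamma_{\mathcal{D}}$ is a $4$-cycle.
   Context: $\mathcal{R}(X)$ is the set of strict linear orders on $X$. A profile over $\mathcal{D}$ is $(R_1,\dots,R_n)\in\mathcal{D}^n$, odd if $n$ is odd; its majority relation ranks $x$ above $y$ iff more than half of the voters do. $\mathcal{D}$ has the representative voter property if for every odd profile over $\mathcal{D}$ there is a voter $i$ whose order $R_i$ coincides with the majority relation. $\mathcal{D}$ is a Condorcet domain if every majority relation of a profile over $\mathcal{D}$ is acyclic, and closed if the majority relation of every odd profile over $\mathcal{D}$ belongs to $\mathcal{D}$. $\mathcal{D}$ has the single-crossing property if its elements can be enumerated $R_1,\dots,R_m$ such that for all distinct $x,y$ the sets $\{j: xR_jy\}$ and $\{j:yR_jx\}$ are intervals of consecutive indices. For $R,R'\in\mathcal{R}(X)$ let $[R,R']=\{Q\in\mathcal{R}(X): Q\supseteq R\cap R'\}$; $\Gamma_{\mathcal{D}}$ is the graph on $\mathcal{D}$ with distinct $R,R'$ adjacent iff $[R,R']\cap\mathcal{D}=\{R,R'\}$. -}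

module Defs where

open import Data.Nat using (ℕ; zero; suc; _+_; _*_; _<_; _≤_; _<ᵇ_)
open import Data.Fin using (Fin; zero; suc; toℕ)
open import Data.Vec using (Vec; []; _∷_; lookup)
open import Data.List using (List; []; _∷_; length)
import Data.List as L
open import Data.List.Membership.Propositional using (_∈_)
open import Data.List.Relation.Unary.All using (All)
open import Data.List.Relation.Unary.Unique.Propositional using (Unique)
open import Data.List.Relation.Binary.Permutation.Propositional using (_↭_)
open import Data.Bool using (Bool; true; false; if_then_else_)
open import Data.Product using (Σ; ∃; _×_; _,_)
open import Data.Sum using (_⊎_)
open import Data.Empty using (⊥)
open import Relation.Nullary using (¬_; does)
open import Relation.Binary.PropositionalEquality using (_≡_; _≢_)
open import Relation.Binary.Construct.Closure.Transitive using (TransClosure)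
open import Function.Bundles using (_⇔_)
import Data.Fin.Properties as FinP

-- The finite set of alternatives is X = Fin k.
-- A strict linear order on Fin k is represented by its ranking: a vector
-- listing the k alternatives from best to worst, without repetition.
Order : ℕ → Set
Order k = Vec (Fin k) k

IsLinearOrder : ∀ {k} → Order k → Set
IsLinearOrder {k} v = ∀ (i j : Fin k) → lookup v i ≡ lookup v j → i ≡ j

rank : ∀ {k m} → Vec (Fin k) m → Fin k → ℕ
rank [] x = 0
rank (y ∷ ys) x = if does (x FinP.≟ y) then 0 else suc (rank ys x)

prefersᵇ : ∀ {k} → Order k → Fin k → Fin k → Bool
prefersᵇ R x y = rank R x <ᵇ rank R y

_≻[_]_ : ∀ {k} → Fin k → Order k → Fin k → Set
x ≻[ R ] y = prefersᵇ R x y ≡ true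

record Domain (k : ℕ) : Set where
  field
    elems  : List (Order k)
    linear : All IsLinearOrder elems
    unique : Unique elems
open Domain public

count : ∀ n → (Fin n → Bool) → ℕ
count zero f = 0
count (suc n) f = (if f zero then 1 else 0) + count n (λ i → f (suc i))

Profile : ∀ {k} → Domain k → ℕ → Set
Profile {k} D n = Σ (Fin n → Order k) λ P → ∀ i → P i ∈ elems D

Maj : ∀ {k n} (D : Domain k) → Profile D n → Fin k → Fin k → Set
Maj {n = n} D (P , _) x y = n < 2 * count n (λ i → prefersᵇ (P i) x y)

Coincides : ∀ {k} → Order k → (Fin k → Fin k → Set) → Set
Coincides R M = ∀ x y → (x ≻[ R ] y) ⇔ M x y

RepresentativeVoter : ∀ {k} → Domain k → Set
RepresentativeVoter D = ∀ m (P : Profile D (suc (2 * m))) →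
  ∃ λ i → Coincides (Data.Product.proj₁ P i) (Maj D P)

Acyclic : ∀ {k} → (Fin k → Fin k → Set) → Set
Acyclic M = ∀ x → ¬ TransClosure M x x

CondorcetDomain : ∀ {k} → Domain k → Set
CondorcetDomain D = ∀ n (P : Profile D n) → Acyclic (Maj D P)

Closed : ∀ {k} → Domain k → Set
Closed D = ∀ m (P : Profile D (suc (2 * m))) →
  ∃ λ R → R ∈ elems D × Coincides R (Maj D P)

IsInterval : ∀ {m} → (Fin m → Set) → Set
IsInterval {m} S = ∀ (i j l : Fin m) → toℕ i ≤ toℕ l → toℕ l ≤ toℕ j →
  S i → S j → S l

SingleCrossing : ∀ {k} → Domain k → Set
SingleCrossing {k} D = Σ (List (Order k)) λ E → E ↭ elems D ×
  (∀ (x y : Fin k) → x ≢ y →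
     IsInterval (λ j → x ≻[ L.lookup E j ] y) ×
     IsInterval (λ j → y ≻[ L.lookup E j ] x))

-- Q ∈ [R, R']  iff  Q ⊇ R ∩ R'  (Q a linear order)
InInterval : ∀ {k} → Order k → Order k → Order k → Set
InInterval R R' Q = ∀ x y → x ≻[ R ] y → x ≻[ R' ] y → x ≻[ Q ] y

Adjacent : ∀ {k} → Domain k → Order k → Order k → Set
Adjacent D R R' = R ≢ R' × R ∈ elems D × R' ∈ elems D ×
  (∀ Q → Q ∈ elems D → InInterval R R' Q → Q ≡ R ⊎ Q ≡ R')

FourCycleGraph : ∀ {k} → Domain k → Set
FourCycleGraph {k} D = Σ (Order k) λ a → Σ (Order k) λ b →
  Σ (Order k) λ c → Σ (Order k) λ d →
    (elems D ↭ (a ∷ b ∷ c ∷ d ∷ [])) ×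
    Adjacent D a b × Adjacent D b c × Adjacent D c d × Adjacent D d a ×
    ¬ Adjacent D a c × ¬ Adjacent D b d

module Submission where

open import Defs
open import Data.Nat using (ℕ; zero; suc; _+_; _*_; _<_; _≤_; _<ᵇ_; z≤n; s≤s)
import Data.Nat as N
import Data.Nat.Properties as NP
open import Data.Fin using (Fin; zero; suc; toℕ; fromℕ<; punchOut)
import Data.Fin.Properties as FP
open import Data.Vec using (Vec; _∷_; lookup)
import Data.Vec.Properties as VP
open import Data.List using (List; []; _∷_; length)
import Data.List as L
open import Data.Bool using (Bool; true; false; T; if_then_else_)
open import Data.Unit using (tt)
open import Data.Empty using (⊥; ⊥-elim)
open import Data.Product using (∃; ∃₂; _×_; _,_; proj₁; proj₂)
open import Data.Sum using (_⊎_; inj₁; inj₂; [_,_]′)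
open import Relation.Nullary using (¬_; Dec; yes; no; does; contradiction; _×-dec_)
open import Relation.Nullary.Decidable using (dec-true; dec-false; _⊎-dec_; _→-dec_)
open import Relation.Binary.PropositionalEquality
  using (_≡_; _≢_; refl; sym; trans; cong; subst; subst₂; module ≡-Reasoning)
open import Relation.Binary using (tri<; tri≈; tri>)
open import Function.Bundles using (_⇔_; mk⇔; Equivalence)
open import Data.List.Membership.Propositional using (_∈_; find)
import Data.List.Membership.Propositional.Properties as MemP
import Data.List.Relation.Unary.All as All
open import Data.List.Relation.Unary.All.Properties.Core using (¬All⇒Any¬)
import Data.List.Sort
import Data.List.Relation.Unary.Sorted.TotalOrder.Properties as SortedP
import Relation.Binary.Construct.On as On
open import Relation.Binary.Bundles using (DecTotalOrder)
open import Data.List.Extrema.Nat using (argmax; argmax-all; f[xs]≤f[argmax])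
import Data.List.Relation.Unary.Any as Any
open import Data.List.Relation.Unary.Any using (here; there)
import Data.List.Relation.Unary.Any.Properties as AnyP
open import Data.List.Relation.Binary.Permutation.Propositional using (_↭_; ↭-refl; ↭-sym; ↭-trans)
import Data.List.Relation.Binary.Permutation.Propositional.Properties as PermP
import Data.List.Relation.Unary.AllPairs as AllPairs
open import Data.List.Relation.Unary.Unique.Propositional using (Unique)
open import Data.List.Membership.Propositional.Properties.WithK using (unique∧set⇒bag)
open import Data.List.Relation.Binary.BagAndSetEquality using (∼bag⇒↭)
open import Data.List.Relation.Binary.Permutation.Propositional.Properties using (∈-resp-↭)
open import Relation.Binary.Construct.Closure.Transitive using (TransClosure; [_]; _∷_)

lookup-rank : ∀ {k m} (v : Vec (Fin k) m) (x : Fin k) (p : rank v x < m) →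
  lookup v (fromℕ< p) ≡ x
lookup-rank (y ∷ ys) x p with x FP.≟ y
... | yes x≡y = sym x≡y
... | no _ = lookup-rank ys x (NP.≤-pred p)

rank-lookup-≤ : ∀ {k m} (v : Vec (Fin k) m) (i : Fin m) → rank v (lookup v i) ≤ toℕ i
rank-lookup-≤ (y ∷ ys) zero with y FP.≟ y
... | yes _ = z≤n
... | no y≢y = contradiction refl y≢y
rank-lookup-≤ (y ∷ ys) (suc i) with lookup ys i FP.≟ y
... | yes _ = z≤n
... | no _ = s≤s (rank-lookup-≤ ys i)

-- A linear ranking of Fin k is a permutation, so every alternative occurs
-- in it (pigeonhole principle).
occurs : ∀ {k} (v : Order k) → IsLinearOrder v → (x : Fin k) → ∃ λ i → lookup v i ≡ x
occurs {suc k} v lin x with FP.any? (λ i → lookup v i FP.≟ x)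
... | yes found = found
... | no missing =
  let avoid = λ i (e : x ≡ lookup v i) → missing (i , sym e)
      (i , j , i<j , same) = FP.pigeonhole (NP.n<1+n k) (λ i → punchOut (avoid i))
  in contradiction (cong toℕ (lin i j (FP.punchOut-injective (avoid i) (avoid j) same)))
                   (NP.<⇒≢ i<j)

rank< : ∀ {k} (v : Order k) → IsLinearOrder v → (x : Fin k) → rank v x < k
rank< v lin x =
  let (i , e) = occurs v lin x
  in subst (λ y → rank v y < _) e (NP.≤-<-trans (rank-lookup-≤ v i) (FP.toℕ<n i))

rank-lookup : ∀ {k} (v : Order k) → IsLinearOrder v → (i : Fin k) →
  rank v (lookup v i) ≡ toℕ i
rank-lookup v lin i =
  let p = rank< v lin (lookup v i)
  in trans (sym (FP.toℕ-fromℕ< p)) (cong toℕ (lin _ _ (lookup-rank v (lookup v i) p)))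

position : ∀ {k} (v : Order k) → IsLinearOrder v → Fin k → Fin k
position v lin x = fromℕ< (rank< v lin x)

toℕ-position : ∀ {k} (v : Order k) (lin : IsLinearOrder v) x → toℕ (position v lin x) ≡ rank v x
toℕ-position v lin x = FP.toℕ-fromℕ< (rank< v lin x)

lookup-position : ∀ {k} (v : Order k) (lin : IsLinearOrder v) x → lookup v (position v lin x) ≡ x
lookup-position v lin x = lookup-rank v x (rank< v lin x)

≻-intro : ∀ {k} (R : Order k) x y → rank R x < rank R y → x ≻[ R ] y
≻-intro R x y p with rank R x <ᵇ rank R y | NP.<⇒<ᵇ p
... | true | _ = refl

≻-elim : ∀ {k} (R : Order k) x y → x ≻[ R ] y → rank R x < rank R y
≻-elim R x y p = NP.<ᵇ⇒< (rank R x) (rank R y) (subst T (sym p) tt)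

≻-irrefl : ∀ {k} (R : Order k) x → ¬ x ≻[ R ] x
≻-irrefl R x p = NP.<-irrefl refl (≻-elim R x x p)

≻-asym : ∀ {k} (R : Order k) x y → x ≻[ R ] y → ¬ y ≻[ R ] x
≻-asym R x y p q = NP.<-asym (≻-elim R x y p) (≻-elim R y x q)

≻-trans : ∀ {k} (R : Order k) {x y z} → x ≻[ R ] y → y ≻[ R ] z → x ≻[ R ] z
≻-trans R {x} {y} {z} p q = ≻-intro R x z (NP.<-trans (≻-elim R x y p) (≻-elim R y z q))

≻⇒≢ : ∀ {k} (R : Order k) {x y} → x ≻[ R ] y → x ≢ y
≻⇒≢ R {x} p refl = ≻-irrefl R x p

≻-connex : ∀ {k} (R : Order k) → IsLinearOrder R → ∀ x y → x ≢ y → x ≻[ R ] y ⊎ y ≻[ R ] x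
≻-connex R lin x y x≢y with NP.<-cmp (rank R x) (rank R y)
... | tri< x<y _ _ = inj₁ (≻-intro R x y x<y)
... | tri≈ _ x≈y _ = contradiction (rank-injective x≈y) x≢y
  where
  rank-injective : rank R x ≡ rank R y → x ≡ y
  rank-injective e = begin
    x                            ≡⟨ sym (lookup-position R lin x) ⟩
    lookup R (position R lin x) ≡⟨ cong (lookup R) (FP.toℕ-injective same) ⟩
    lookup R (position R lin y) ≡⟨ lookup-position R lin y ⟩
    y                            ∎
    where
    open ≡-Reasoning
    same : toℕ (position R lin x) ≡ toℕ (position R lin y)
    same = trans (toℕ-position R lin x) (trans e (sym (toℕ-position R lin y)))
... | tri> _ _ y<x = inj₂ (≻-intro R y x y<x)

above⇒earlier : ∀ {k} (w : Order k) (lin : IsLinearOrder w) (i : Fin k) {x} →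
  x ≻[ w ] lookup w i → ∃ λ j → toℕ j < toℕ i × lookup w j ≡ x
above⇒earlier w lin i {x} x≻ =
  position w lin x ,
  subst₂ _<_ (sym (toℕ-position w lin x)) (rank-lookup w lin i) (≻-elim w x _ x≻) ,
  lookup-position w lin x

-- Two linear orders, one contained in the other, are equal: by strong
-- induction on positions, both rankings list the same entry at each position.
⊆⇒≡ : ∀ {k} (v w : Order k) → IsLinearOrder v → IsLinearOrder w →
  (∀ x y → x ≻[ v ] y → x ≻[ w ] y) → v ≡ w
⊆⇒≡ {k} v w lv lw v⊆w =
  trans (sym (VP.tabulate∘lookup v))
    (trans (VP.tabulate-cong (λ i → agree (suc (toℕ i)) i NP.≤-refl)) (VP.tabulate∘lookup w))
  where
  agree : ∀ n (i : Fin k) → toℕ i < n → lookup v i ≡ lookup w i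
  agree (suc n) i i<sn with lookup v i FP.≟ lookup w i
  ... | yes same = same
  ... | no differ with ≻-connex v lv _ _ differ
  ...   | inj₁ vi≻wi =
          let (j , j<i , wj≡vi) = above⇒earlier w lw i (v⊆w _ _ vi≻wi)
              vj≡vi = trans (agree n j (NP.<-≤-trans j<i (NP.≤-pred i<sn))) wj≡vi
          in contradiction (cong toℕ (lv j i vj≡vi)) (NP.<⇒≢ j<i)
  ...   | inj₂ wi≻vi =
          let (j , j<i , vj≡wi) = above⇒earlier v lv i wi≻vi
              wj≡wi = trans (sym (agree n j (NP.<-≤-trans j<i (NP.≤-pred i<sn)))) vj≡wi
          in contradiction (cong toℕ (lw j i wj≡wi)) (NP.<⇒≢ j<i)

-- q lies between r and s (q ∈ [r, s]): q keeps every comparison on which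
-- r and s agree.
Between : ∀ {k} → Order k → Order k → Order k → Set
Between q r s = InInterval r s q

between-left : ∀ {k} (r s : Order k) → Between r r s
between-left r s x y r≻ _ = r≻

between-right : ∀ {k} (r s : Order k) → Between s r s
between-right r s x y _ s≻ = s≻

between-sym : ∀ {k} (q r s : Order k) → Between q r s → Between q s r
between-sym q r s q∈rs x y s≻ r≻ = q∈rs x y r≻ s≻

between-trans : ∀ {k} (p q r s : Order k) → Between q r s → Between p r q → Between p r s
between-trans p q r s q∈rs p∈rq x y r≻ s≻ = p∈rq x y r≻ (q∈rs x y r≻ s≻)

between? : ∀ {k} (q r s : Order k) → Dec (Between q r s)
between? q r s = FP.all? λ x → FP.all? λ y →
  (prefersᵇ r x y Data.Bool.≟ true) →-dec (prefersᵇ s x y Data.Bool.≟ true) →-dec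
  (prefersᵇ q x y Data.Bool.≟ true)

-- Facts about betweenness that need linear orders.  Each is proved
-- comparison by comparison, using connexity to pick the relevant direction.
module _ {k : ℕ} where
  private
    Lin : Order k → Set
    Lin = IsLinearOrder {k}

  between-antisym : (a b c : Order k) → Lin a → Lin b → Lin c →
    Between a b c → Between b a c → a ≡ b
  between-antisym a b c la lb lc a∈bc b∈ac = sym (⊆⇒≡ b a lb la b⊆a)
    where
    b⊆a : ∀ x y → x ≻[ b ] y → x ≻[ a ] y
    b⊆a x y b≻ with ≻-connex c lc x y (≻⇒≢ b b≻)
    ... | inj₁ c≻ = a∈bc x y b≻ c≻
    ... | inj₂ c≺ with ≻-connex a la x y (≻⇒≢ b b≻)
    ...   | inj₁ a≻ = a≻
    ...   | inj₂ a≺ = contradiction (b∈ac y x a≺ c≺) (≻-asym b x y b≻)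

  between-ray : (a i j l : Order k) → Lin a → Lin j →
    Between i a j → Between j a l → Between j i l
  between-ray a i j l la lj i∈aj j∈al x y i≻ l≻ with ≻-connex a la x y (≻⇒≢ i i≻)
  ... | inj₁ a≻ = j∈al x y a≻ l≻
  ... | inj₂ a≺ with ≻-connex j lj x y (≻⇒≢ i i≻)
  ...   | inj₁ j≻ = j≻
  ...   | inj₂ j≺ = contradiction (i∈aj y x a≺ j≺) (≻-asym i x y i≻)

  between-shrink : (a b p q : Order k) → Lin b → Lin q →
    Between p b q → Between q a b → Between q a p
  between-shrink a b p q lb lq p∈bq q∈ab x y a≻ p≻ with ≻-connex b lb x y (≻⇒≢ a a≻)
  ... | inj₁ b≻ = q∈ab x y a≻ b≻
  ... | inj₂ b≺ with ≻-connex q lq x y (≻⇒≢ a a≻)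
  ...   | inj₁ q≻ = q≻
  ...   | inj₂ q≺ = contradiction (p∈bq y x b≺ q≺) (≻-asym p x y p≻)

  between-swap-end : (a b p q r : Order k) → Lin p → Lin r →
    Between r a b → Between b p q → Between a p r → Between r a q
  between-swap-end a b p q r lp lr r∈ab b∈pq a∈pr x y a≻ q≻ with ≻-connex r lr x y (≻⇒≢ a a≻)
  ... | inj₁ r≻ = r≻
  ... | inj₂ r≺ with ≻-connex p lp x y (≻⇒≢ a a≻)
  ...   | inj₂ p≺ = contradiction (a∈pr y x p≺ r≺) (≻-asym a x y a≻)
  ...   | inj₁ p≻ = contradiction (r∈ab x y a≻ (b∈pq x y p≻ q≻)) (≻-asym r y x r≺)

  between-far-end : (a b p r : Order k) → Lin a → Lin r →
    Between r a b → Between p a r → Between r b p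
  between-far-end a b p r la lr r∈ab p∈ar x y b≻ p≻ with ≻-connex r lr x y (≻⇒≢ b b≻)
  ... | inj₁ r≻ = r≻
  ... | inj₂ r≺ with ≻-connex a la x y (≻⇒≢ b b≻)
  ...   | inj₂ a≺ = contradiction (p∈ar y x a≺ r≺) (≻-asym p x y p≻)
  ...   | inj₁ a≻ = contradiction (r∈ab x y a≻ b≻) (≻-asym r y x r≺)

  between-corner : (a p q r : Order k) → Lin a → Lin p → Lin q → Lin r →
    Between r a p → Between r a q → Between a p q → r ≡ a
  between-corner a p q r la lp lq lr r∈ap r∈aq a∈pq = sym (⊆⇒≡ a r la lr a⊆r)
    where
    a⊆r : ∀ x y → x ≻[ a ] y → x ≻[ r ] y
    a⊆r x y a≻ with ≻-connex p lp x y (≻⇒≢ a a≻)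
    ... | inj₁ p≻ = r∈ap x y a≻ p≻
    ... | inj₂ p≺ with ≻-connex q lq x y (≻⇒≢ a a≻)
    ...   | inj₁ q≻ = r∈aq x y a≻ q≻
    ...   | inj₂ q≺ = contradiction (a∈pq y x p≺ q≺) (≻-asym a x y a≻)

  between-crossed : (a b p q r : Order k) → Lin a → Lin b → Lin p → Lin q →
    Between r a p → Between r b q → Between b p q → Between p a b → Between r a b → p ≡ b
  between-crossed a b p q r la lb lp lq r∈ap r∈bq b∈pq p∈ab r∈ab = sym (⊆⇒≡ b p lb lp b⊆p)
    where
    b⊆p : ∀ x y → x ≻[ b ] y → x ≻[ p ] y
    b⊆p x y b≻ with ≻-connex p lp x y (≻⇒≢ b b≻)
    ... | inj₁ p≻ = p≻
    ... | inj₂ p≺ with ≻-connex q lq x y (≻⇒≢ b b≻)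
    ...   | inj₂ q≺ = contradiction (b∈pq y x p≺ q≺) (≻-asym b x y b≻)
    ...   | inj₁ q≻ with ≻-connex a la x y (≻⇒≢ b b≻)
    ...     | inj₂ a≺ = contradiction (r∈ap y x a≺ p≺) (≻-asym r x y (r∈bq x y b≻ q≻))
    ...     | inj₁ a≻ = contradiction (p∈ab x y a≻ b≻) (≻-asym p y x p≺)

does-true : ∀ {P : Set} (d : Dec P) → does d ≡ true → P
does-true (yes p) _ = p

does-false : ∀ {P : Set} (d : Dec P) → does d ≡ false → ¬ P
does-false (no ¬p) _ = ¬p

ind : Bool → ℕ
ind b = if b then 1 else 0

count-mono : ∀ n (f g : Fin n → Bool) → (∀ i → f i ≡ true → g i ≡ true) →
  count n f ≤ count n g
count-mono zero f g f⊆g = z≤n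
count-mono (suc n) f g f⊆g with f zero in ef | g zero in eg
... | true  | true  = s≤s (count-mono n _ _ (λ i → f⊆g (suc i)))
... | false | true  = NP.m≤n⇒m≤1+n (count-mono n _ _ (λ i → f⊆g (suc i)))
... | false | false = count-mono n _ _ (λ i → f⊆g (suc i))
... | true  | false = contradiction (trans (sym (f⊆g zero ef)) eg) λ ()

count-strict : ∀ n (f g : Fin n → Bool) → (∀ i → f i ≡ true → g i ≡ true) →
  ∀ j → g j ≡ true → f j ≡ false → count n f < count n g
count-strict (suc n) f g f⊆g zero gj fj rewrite gj | fj =
  s≤s (count-mono n _ _ (λ i → f⊆g (suc i)))
count-strict (suc n) f g f⊆g (suc j) gj fj with f zero in ef | g zero in eg
... | true  | true  = s≤s (count-strict n _ _ (λ i → f⊆g (suc i)) j gj fj)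
... | false | true  = NP.m≤n⇒m≤1+n (count-strict n _ _ (λ i → f⊆g (suc i)) j gj fj)
... | false | false = count-strict n _ _ (λ i → f⊆g (suc i)) j gj fj
... | true  | false = contradiction (trans (sym (f⊆g zero ef)) eg) λ ()

count-all : ∀ n (f : Fin n → Bool) → (∀ i → f i ≡ true) → count n f ≡ n
count-all zero f all = refl
count-all (suc n) f all rewrite all zero = cong suc (count-all n _ (λ i → all (suc i)))

count-none : ∀ n (f : Fin n → Bool) → (∀ i → f i ≡ false) → count n f ≡ 0
count-none zero f none = refl
count-none (suc n) f none rewrite none zero = count-none n _ (λ i → none (suc i))

count-cover : ∀ n (f g : Fin n → Bool) → (∀ i → f i ≡ true ⊎ g i ≡ true) →
  n ≤ count n f + count n g
count-cover zero f g cover = z≤n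
count-cover (suc n) f g cover with f zero | g zero | cover zero
... | true  | true  | _ =
  s≤s (NP.≤-trans (count-cover n _ _ (λ i → cover (suc i))) (NP.+-monoʳ-≤ (count n _) (NP.n≤1+n _)))
... | true  | false | _ = s≤s (count-cover n _ _ (λ i → cover (suc i)))
... | false | true  | _ = subst (suc n ≤_) (sym (NP.+-suc (count n _) (count n _)))
                              (s≤s (count-cover n _ _ (λ i → cover (suc i))))
... | false | false | inj₁ ()
... | false | false | inj₂ ()

count-disjoint : ∀ n (f g : Fin n → Bool) → (∀ i → f i ≡ true → g i ≡ true → ⊥) →
  count n f + count n g ≤ n
count-disjoint zero f g disj = z≤n
count-disjoint (suc n) f g disj with f zero in ef | g zero in eg
... | true  | true  = ⊥-elim (disj zero ef eg)
... | true  | false = s≤s (count-disjoint n _ _ (λ i → disj (suc i)))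
... | false | true  = subst (_≤ suc n) (sym (NP.+-suc (count n _) (count n _)))
                        (s≤s (count-disjoint n _ _ (λ i → disj (suc i))))
... | false | false = NP.m≤n⇒m≤1+n (count-disjoint n _ _ (λ i → disj (suc i)))

count-union : ∀ n (h f g : Fin n → Bool) → (∀ i → h i ≡ true → f i ≡ true ⊎ g i ≡ true) →
  count n h ≤ count n f + count n g
count-union zero h f g split = z≤n
count-union (suc n) h f g split with h zero in eh
... | false = NP.≤-trans (count-union n _ _ _ (λ i → split (suc i)))
                (NP.+-mono-≤ (NP.m≤n+m _ (ind (f zero))) (NP.m≤n+m _ (ind (g zero))))
... | true with split zero eh
...   | inj₁ f₀ rewrite f₀ =
  s≤s (NP.≤-trans (count-union n _ _ _ (λ i → split (suc i)))
         (NP.+-monoʳ-≤ (count n (λ i → f (suc i))) (NP.m≤n+m _ (ind (g zero)))))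
...   | inj₂ g₀ rewrite g₀ = begin
  suc (count n h′)                             ≤⟨ s≤s (count-union n h′ f′ g′ (λ i → split (suc i))) ⟩
  suc (count n f′ + count n g′)                ≤⟨ s≤s (NP.+-monoˡ-≤ (count n g′) (NP.m≤n+m _ (ind (f zero)))) ⟩
  suc (ind (f zero) + count n f′ + count n g′) ≡⟨ NP.+-suc _ (count n g′) ⟨
  ind (f zero) + count n f′ + suc (count n g′) ∎
  where
  open NP.≤-Reasoning
  h′ f′ g′ : Fin n → Bool
  h′ i = h (suc i)
  f′ i = f (suc i)
  g′ i = g (suc i)

count-witness : ∀ n (f g : Fin n → Bool) → count n g < count n f →
  ∃ λ i → f i ≡ true × g i ≡ false
count-witness (suc n) f g lt with f zero in ef | g zero in eg
... | true  | false = zero , ef , eg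
... | true  | true  = let (i , fi , gi) = count-witness n _ _ (NP.≤-pred lt) in suc i , fi , gi
... | false | false = let (i , fi , gi) = count-witness n _ _ lt in suc i , fi , gi
... | false | true  = let (i , fi , gi) = count-witness n _ _ (NP.<-trans (NP.n<1+n _) lt)
                      in suc i , fi , gi

count-positive : ∀ n (f : Fin n → Bool) → 0 < count n f → ∃ λ i → f i ≡ true
count-positive n f pos =
  let (i , fi , _) = count-witness n f (λ _ → false)
                       (subst (_< count n f) (sym (count-none n _ (λ _ → refl))) pos)
  in i , fi

2*suc : ∀ m → 2 * suc m ≡ suc (suc (2 * m))
2*suc m = cong suc (NP.+-suc m (m + 0))

odd-majority : ∀ m c → m < c → suc (2 * m) < 2 * c
odd-majority m c m<c = subst (_≤ 2 * c) (2*suc m) (NP.*-monoʳ-≤ 2 m<c)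

complement-small : ∀ m a b → suc (2 * m) ≤ a + b → b ≤ m → m < a
complement-small m a b n≤a+b b≤m =
  NP.+-cancelʳ-≤ m (suc m) a (subst (_≤ a + m) n≡ (NP.≤-trans n≤a+b (NP.+-monoʳ-≤ a b≤m)))
  where
  n≡ : suc (2 * m) ≡ suc m + m
  n≡ = cong suc (cong (m +_) (NP.+-identityʳ m))

two-majorities : ∀ n a b → n < 2 * a → n < 2 * b → a + b ≤ n → ⊥
two-majorities n a b n<2a n<2b a+b≤n = NP.<-irrefl refl (NP.<-≤-trans (NP.+-mono-< n<2a n<2b) bound)
  where
  bound : 2 * a + 2 * b ≤ n + n
  bound = subst (_≤ n + n) (NP.*-distribˡ-+ 2 a b)
            (NP.≤-trans (NP.*-monoʳ-≤ 2 a+b≤n) (NP.≤-reflexive (cong (n +_) (NP.+-identityʳ n))))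

even-majority-extends : ∀ j c d → 2 * j < 2 * c → suc (2 * j) < 2 * (d + c)
even-majority-extends j c d 2j<2c =
  NP.≤-trans (subst (_≤ 2 * c) (2*suc j) (NP.*-monoʳ-≤ 2 (NP.*-cancelˡ-< 2 j c 2j<2c)))
             (NP.*-monoʳ-≤ 2 (NP.m≤n+m c d))

module _ {k : ℕ} (D : Domain k) where

  support : ∀ {n} → Profile D n → Fin k → Fin k → ℕ
  support {n} (P , _) x y = count n (λ i → prefersᵇ (P i) x y)

  majority-by : ∀ {m} (P : Profile D (suc (2 * m))) (group : Fin (suc (2 * m)) → Bool) x y →
    m < count (suc (2 * m)) group → (∀ i → group i ≡ true → x ≻[ proj₁ P i ] y) → Maj D P x y
  majority-by {m} P group x y big prefer =
    odd-majority m (support P x y) (NP.≤-trans big (count-mono _ group _ prefer))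

  maj-irrefl : ∀ {n} (P : Profile D n) x → ¬ Maj D P x x
  maj-irrefl {n} P x mx = NP.n≮0 (subst (λ c → n < 2 * c) none mx)
    where
    prefersᵇ-irrefl : ∀ R → prefersᵇ R x x ≡ false
    prefersᵇ-irrefl R with prefersᵇ R x x in e
    ... | false = refl
    ... | true = contradiction e (≻-irrefl R x)
    none : support P x x ≡ 0
    none = count-none n _ (λ i → prefersᵇ-irrefl (proj₁ P i))

  maj-asym : ∀ {n} (P : Profile D n) x y → Maj D P x y → ¬ Maj D P y x
  maj-asym {n} P x y mxy myx = two-majorities n (support P x y) (support P y x) mxy myx
    (count-disjoint n _ _ (λ i → ≻-asym (proj₁ P i) x y))

  -- A linear order whose comparisons are all majority comparisons coincides
  -- with the majority relation: the majority relation is asymmetric and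
  -- irreflexive, while a linear order compares every pair.
  ⊆maj⇒coincides : ∀ {n} (P : Profile D n) (R : Order k) → IsLinearOrder R →
    (∀ x y → x ≻[ R ] y → Maj D P x y) → Coincides R (Maj D P)
  ⊆maj⇒coincides P R lin R⊆maj x y = mk⇔ (R⊆maj x y) maj⊆R
    where
    maj⊆R : Maj D P x y → x ≻[ R ] y
    maj⊆R mxy with x FP.≟ y
    ... | yes refl = contradiction mxy (maj-irrefl P x)
    ... | no x≢y with ≻-connex R lin x y x≢y
    ...   | inj₁ x≻y = x≻y
    ...   | inj₂ y≻x = contradiction (R⊆maj y x y≻x) (maj-asym P x y mxy)

majority-of-two : ∀ (f : Fin 3 → Bool) i → (∀ j → j ≢ i → f j ≡ true) → 1 < count 3 f
majority-of-two f zero others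
  rewrite others (suc zero) (λ ()) | others (suc (suc zero)) (λ ()) = NP.m≤n+m 2 _
majority-of-two f (suc zero) others
  rewrite others zero (λ ()) | others (suc (suc zero)) (λ ()) = s≤s (NP.m≤n+m 1 _)
majority-of-two f (suc (suc zero)) others
  rewrite others zero (λ ()) | others (suc zero) (λ ()) = s≤s (s≤s z≤n)

⊆order⇒acyclic : ∀ {k} (R : Order k) (M : Fin k → Fin k → Set) →
  (∀ x y → M x y → x ≻[ R ] y) → Acyclic M
⊆order⇒acyclic R M M⊆R x cycle = ≻-irrefl R x (path⇒≻ cycle)
  where
  path⇒≻ : ∀ {x y} → TransClosure M x y → x ≻[ R ] y
  path⇒≻ [ m ] = M⊆R _ _ m
  path⇒≻ (m ∷ path) = ≻-trans R (M⊆R _ _ m) (path⇒≻ path)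

data Parity : ℕ → Set where
  even : ∀ m → Parity (2 * m)
  odd  : ∀ m → Parity (suc (2 * m))

parity : ∀ n → Parity n
parity zero = even 0
parity (suc n) with parity n
... | even m = odd m
... | odd m = subst Parity (2*suc m) (even (suc m))

module _ {k : ℕ} (D : Domain k) (rv : RepresentativeVoter D) where

  -- Of any three orders of D, one lies between the other two: the
  -- representative voter of the three-voter profile agrees with every
  -- comparison on which the other two voters agree.
  middle-of-three : ∀ {r s t} → r ∈ elems D → s ∈ elems D → t ∈ elems D →
    Between r s t ⊎ (Between s r t ⊎ Between t r s)
  middle-of-three {r} {s} {t} r∈ s∈ t∈ = from-representative (rv 1 trio)
    where
    voters : Fin 3 → Order k
    voters = λ { zero → r ; (suc zero) → s ; (suc (suc zero)) → t }
    trio : Profile D 3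
    trio = voters , λ { zero → r∈ ; (suc zero) → s∈ ; (suc (suc zero)) → t∈ }
    shared : ∀ i x y → (∀ j → j ≢ i → x ≻[ voters j ] y) → Maj D trio x y
    shared i x y others =
      odd-majority 1 _ (majority-of-two (λ j → prefersᵇ (voters j) x y) i others)
    from-representative : ∃ (λ i → Coincides (voters i) (Maj D trio)) →
      Between r s t ⊎ (Between s r t ⊎ Between t r s)
    from-representative (zero , rep) = inj₁ λ x y s≻ t≻ → Equivalence.from (rep x y)
      (shared zero x y λ { zero 0≢0 → contradiction refl 0≢0
                         ; (suc zero) _ → s≻ ; (suc (suc zero)) _ → t≻ })
    from-representative (suc zero , rep) = inj₂ (inj₁ λ x y r≻ t≻ → Equivalence.from (rep x y)
      (shared (suc zero) x y λ { zero _ → r≻ ; (suc zero) 1≢1 → contradiction refl 1≢1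
                               ; (suc (suc zero)) _ → t≻ }))
    from-representative (suc (suc zero) , rep) = inj₂ (inj₂ λ x y r≻ s≻ → Equivalence.from (rep x y)
      (shared (suc (suc zero)) x y λ { zero _ → r≻ ; (suc zero) _ → s≻
                                     ; (suc (suc zero)) 2≢2 → contradiction refl 2≢2 }))

  rv⇒closed : Closed D
  rv⇒closed m P = let (i , rep) = rv m P in proj₁ P i , proj₂ P i , rep

  -- Odd majority relations coincide with a voter's order, hence are acyclic;
  -- an even profile with 2(j+1) voters is extended by a copy of its first
  -- voter, which keeps every majority comparison, and the empty profile has
  -- no majority comparisons at all.
  rv⇒condorcet : CondorcetDomain D
  rv⇒condorcet n P with parity n
  ... | odd m = let (i , rep) = rv m P in
    ⊆order⇒acyclic (proj₁ P i) _ (λ x y → Equivalence.from (rep x y))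
  ... | even zero = λ x cycle → no-majority cycle
    where
    no-majority : ∀ {x y} → TransClosure (Maj D P) x y → ⊥
    no-majority [ () ]
    no-majority (() ∷ _)
  ... | even (suc j) =
    let (i , rep) = rv (suc j) Q
    in ⊆order⇒acyclic (proj₁ Q i) _ (λ x y mxy → Equivalence.from (rep x y) (extends mxy))
    where
    Q : Profile D (suc (2 * suc j))
    Q = (λ { zero → proj₁ P zero ; (suc i) → proj₁ P i })
      , (λ { zero → proj₂ P zero ; (suc i) → proj₂ P i })
    extends : ∀ {x y} → Maj D P x y → Maj D Q x y
    extends {x} {y} = even-majority-extends (suc j) (support D P x y)
      (ind (prefersᵇ (proj₁ P zero) x y))

module Median (m : ℕ) (pos : Fin (suc (2 * m)) → ℕ) where
  private
    n : ℕ
    n = suc (2 * m)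

  below atMost atLeast : ℕ → Fin n → Bool
  below   t j = does (pos j N.<? t)
  atMost  t   = below (suc t)
  atLeast t j = does (t N.≤? pos j)

  least-threshold : ∀ t → m < count n (atMost t) →
    ∃ λ S → m < count n (atMost S) × count n (below S) ≤ m
  least-threshold zero big =
    0 , big , NP.≤-trans (NP.≤-reflexive (count-none n _ (λ j → dec-false (pos j N.<? 0) λ ()))) z≤n
  least-threshold (suc t) big with m N.<? count n (atMost t)
  ... | yes big-earlier = least-threshold t big-earlier
  ... | no small-earlier = suc t , big , NP.≮⇒≥ small-earlier

  above-or-below : ∀ S j → atLeast S j ≡ true ⊎ below S j ≡ true
  above-or-below S j with S N.≤? pos j
  ... | yes S≤j = inj₁ (dec-true (S N.≤? pos j) S≤j)
  ... | no S≰j = inj₂ (dec-true (pos j N.<? S) (NP.≰⇒> S≰j))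

  median : ∀ B → (∀ j → pos j ≤ B) →
    ∃ λ i → m < count n (atMost (pos i)) × m < count n (atLeast (pos i))
  median B bounded with least-threshold B (subst (m <_) (sym everyone) (s≤s (NP.m≤m+n m (m + 0))))
    where
    everyone : count n (atMost B) ≡ n
    everyone = count-all n (atMost B) (λ j → dec-true (pos j N.<? suc B) (s≤s (bounded j)))
  ... | S , big , few-below
    with count-witness n (atMost S) (below S) (NP.≤-<-trans few-below big)
  ... | i , at-most-S , not-below-S = i , big-at-i , big-above-at-i
    where
    i-at-S : pos i ≡ S
    i-at-S = NP.≤∧≮⇒≡ (NP.≤-pred (does-true (pos i N.<? suc S) at-most-S))
                      (does-false (pos i N.<? S) not-below-S)
    big-at-i : m < count n (atMost (pos i))
    big-at-i = subst (λ T → m < count n (atMost T)) (sym i-at-S) big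
    big-above-at-i : m < count n (atLeast (pos i))
    big-above-at-i = subst (λ T → m < count n (atLeast T)) (sym i-at-S)
      (complement-small m (count n (atLeast S)) (count n (below S))
        (count-cover n (atLeast S) (below S) (above-or-below S)) few-below)

-- In a single-crossing enumeration, if the order at position s ranks x above
-- y, then so do all orders at positions up to s or all orders from s on:
-- otherwise orders on both sides of s rank y above x, and so would the order
-- at s, the orders ranking y above x forming an interval.
one-side : ∀ {k L} (order : Fin L → Order k) → (∀ j → IsLinearOrder (order j)) →
  ∀ {x y} → IsInterval (λ j → y ≻[ order j ] x) → ∀ s → x ≻[ order s ] y →
  (∀ j → toℕ j ≤ toℕ s → x ≻[ order j ] y) ⊎ (∀ j → toℕ s ≤ toℕ j → x ≻[ order j ] y)
one-side order lin {x} {y} y≻x-interval s x≻y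
  with FP.any? (λ j → (toℕ j N.≤? toℕ s) ×-dec (prefersᵇ (order j) y x Data.Bool.≟ true))
... | no none-below = inj₁ λ j j≤s → x-above j (λ y≻x → none-below (j , j≤s , y≻x))
  where
  x-above : ∀ j → ¬ y ≻[ order j ] x → x ≻[ order j ] y
  x-above j ¬y≻x with ≻-connex (order j) (lin j) x y (≻⇒≢ (order s) x≻y)
  ... | inj₁ x≻ = x≻
  ... | inj₂ y≻ = contradiction y≻ ¬y≻x
... | yes (j₀ , j₀≤s , y≻x) = inj₂ λ j s≤j →
  [ (λ x≻ → x≻)
  , (λ y≻ → contradiction (y≻x-interval j₀ j s j₀≤s s≤j y≻x y≻) (≻-asym (order s) x y x≻y)) ]′
  (≻-connex (order j) (lin j) x y (≻⇒≢ (order s) x≻y))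

-- A single-crossing domain has the representative voter property: place
-- every voter at the position of its order in the enumeration and take a
-- median voter.  By one-side, each comparison of the median order is shared
-- by all voters weakly on one side of the median, and these are a majority.
sc⇒rv : ∀ {k} (D : Domain k) → SingleCrossing D → RepresentativeVoter D
sc⇒rv {k} D (E , E↭D , crossing) m P =
  i , ⊆maj⇒coincides D P (voter i) (voter-linear i) median⊆maj
  where
  open Median m
  voter : Fin (suc (2 * m)) → Order k
  voter = proj₁ P
  order : Fin (length E) → Order k
  order = L.lookup E
  order-linear : ∀ j → IsLinearOrder (order j)
  order-linear j = All.lookup (linear D) (∈-resp-↭ E↭D (MemP.∈-lookup j))
  index : Fin (suc (2 * m)) → Fin (length E)
  index j = Any.index (∈-resp-↭ (↭-sym E↭D) (proj₂ P j))
  voter-at-index : ∀ j → voter j ≡ order (index j)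
  voter-at-index j = AnyP.lookup-index (∈-resp-↭ (↭-sym E↭D) (proj₂ P j))
  voter-linear : ∀ j → IsLinearOrder (voter j)
  voter-linear j = All.lookup (linear D) (proj₂ P j)
  pos : Fin (suc (2 * m)) → ℕ
  pos j = toℕ (index j)
  median-voter : ∃ λ i → m < count (suc (2 * m)) (atMost pos (pos i))
                        × m < count (suc (2 * m)) (atLeast pos (pos i))
  median-voter = median pos (length E) (λ j → NP.<⇒≤ (FP.toℕ<n (index j)))
  i : Fin (suc (2 * m))
  i = proj₁ median-voter
  prefers-at : ∀ j {x y} → x ≻[ order (index j) ] y → x ≻[ voter j ] y
  prefers-at j {x} {y} = subst (λ R → x ≻[ R ] y) (sym (voter-at-index j))
  median⊆maj : ∀ x y → x ≻[ voter i ] y → Maj D P x y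
  median⊆maj x y x≻y
    with one-side order order-linear (proj₂ (crossing x y (≻⇒≢ (voter i) x≻y))) (index i)
           (subst (λ R → x ≻[ R ] y) (voter-at-index i) x≻y)
  ... | inj₁ lower = majority-by D P (atMost pos (pos i)) x y (proj₁ (proj₂ median-voter))
          λ j e → prefers-at j (lower (index j) (NP.≤-pred (does-true (pos j N.<? suc (pos i)) e)))
  ... | inj₂ upper = majority-by D P (atLeast pos (pos i)) x y (proj₂ (proj₂ median-voter))
          λ j e → prefers-at j (upper (index j) (does-true (pos i N.≤? pos j) e))

_≟O_ : ∀ {k} → (u v : Order k) → Dec (u ≡ v)
_≟O_ = VP.≡-dec FP._≟_

module Weights {k : ℕ} (D : Domain k) (m : ℕ) (P : Profile D (suc (2 * m))) where
  private
    n : ℕ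
    n = suc (2 * m)

  voter : Fin n → Order k
  voter = proj₁ P

  voter-linear : ∀ i → IsLinearOrder (voter i)
  voter-linear i = All.lookup (linear D) (proj₂ P i)

  holds : Order k → Fin n → Bool
  holds u j = does (voter j ≟O u)

  weight : Order k → ℕ
  weight u = count n (holds u)

  heavy⇒representative : ∀ u → m < weight u → ∃ λ i → Coincides (voter i) (Maj D P)
  heavy⇒representative u heavy = i , ⊆maj⇒coincides D P (voter i) (voter-linear i) i⊆maj
    where
    holder : ∃ λ i → holds u i ≡ true
    holder = count-positive n (holds u) (NP.≤-<-trans z≤n heavy)
    i : Fin n
    i = proj₁ holder
    i-holds : voter i ≡ u
    i-holds = does-true (voter i ≟O u) (proj₂ holder)
    i⊆maj : ∀ x y → x ≻[ voter i ] y → Maj D P x y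
    i⊆maj x y x≻y = majority-by D P (holds u) x y heavy λ j j-holds →
      subst (λ R → x ≻[ R ] y) (trans i-holds (sym (does-true (voter j ≟O u) j-holds))) x≻y

  light-everywhere : (∀ i → weight (voter i) ≤ m) → ∀ u → weight u ≤ m
  light-everywhere light u with m N.<? weight u
  ... | no ¬heavy = NP.≮⇒≥ ¬heavy
  ... | yes heavy =
    let (j , j-holds) = count-positive n (holds u) (NP.≤-<-trans z≤n heavy)
    in contradiction (subst (λ v → m < weight v) (sym (does-true (voter j ≟O u) j-holds)) heavy)
                     (NP.≤⇒≯ (light j))

  holdsEither : Order k → Order k → Fin n → Bool
  holdsEither u₁ u₂ j = does ((voter j ≟O u₁) ⊎-dec (voter j ≟O u₂))

  majority-between : ∀ R u₁ u₂ → Coincides R (Maj D P) →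
    m < count n (holdsEither u₁ u₂) → Between R u₁ u₂
  majority-between R u₁ u₂ R≡maj heavy x y u₁≻ u₂≻ =
    Equivalence.from (R≡maj x y) (majority-by D P (holdsEither u₁ u₂) x y heavy prefer)
    where
    prefer : ∀ j → holdsEither u₁ u₂ j ≡ true → x ≻[ voter j ] y
    prefer j e with does-true ((voter j ≟O u₁) ⊎-dec (voter j ≟O u₂)) e
    ... | inj₁ refl = u₁≻
    ... | inj₂ refl = u₂≻

  either-bound : ∀ u₁ u₂ → count n (holdsEither u₁ u₂) ≤ weight u₁ + weight u₂
  either-bound u₁ u₂ = count-union n (holdsEither u₁ u₂) (holds u₁) (holds u₂) split
    where
    split : ∀ j → holdsEither u₁ u₂ j ≡ true → holds u₁ j ≡ true ⊎ holds u₂ j ≡ true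
    split j e with does-true ((voter j ≟O u₁) ⊎-dec (voter j ≟O u₂)) e
    ... | inj₁ e₁ = inj₁ (dec-true (voter j ≟O u₁) e₁)
    ... | inj₂ e₂ = inj₂ (dec-true (voter j ≟O u₂) e₂)

  -- In a domain forming the 4-cycle a b c d with edge (b, c), an order R = a
  -- coinciding with the majority relation is held by some voter, unless some
  -- order is heavy: otherwise all voters hold b, c or d; those holding b or c
  -- are a majority since d is light, so R ∈ [b, c] and by adjacency R is b
  -- or c; but then only one of b, c is held, by a light minority.
  cycle-case : ∀ {R a b c d} → elems D ↭ a ∷ b ∷ c ∷ d ∷ [] → Adjacent D b c → R ≡ a →
    R ∈ elems D → Coincides R (Maj D P) → (∀ i → voter i ≢ R) → (∀ u → weight u ≤ m) → ⊥
  cycle-case {R} {a} {b} {c} {d} D↭ (_ , _ , _ , bc-edge) refl R∈ R≡maj unheld light =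
    edge-endpoint (bc-edge R R∈ (majority-between R b c R≡maj b∨c-majority))
    where
    b∨c-or-d : ∀ j → holdsEither b c j ≡ true ⊎ holds d j ≡ true
    b∨c-or-d j with ∈-resp-↭ D↭ (proj₂ P j)
    ... | here e = contradiction e (unheld j)
    ... | there (here e) = inj₁ (dec-true ((voter j ≟O b) ⊎-dec (voter j ≟O c)) (inj₁ e))
    ... | there (there (here e)) = inj₁ (dec-true ((voter j ≟O b) ⊎-dec (voter j ≟O c)) (inj₂ e))
    ... | there (there (there (here e))) = inj₂ (dec-true (voter j ≟O d) e)
    b∨c-majority : m < count n (holdsEither b c)
    b∨c-majority = complement-small m _ _ (count-cover n _ _ b∨c-or-d) (light d)
    unweighted : weight R ≡ 0
    unweighted = count-none n (holds R) (λ j → dec-false (voter j ≟O R) (unheld j))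
    edge-endpoint : R ≡ b ⊎ R ≡ c → ⊥
    edge-endpoint (inj₁ refl) = NP.<⇒≱ b∨c-majority
      (NP.≤-trans (either-bound b c) (NP.+-mono-≤ (NP.≤-reflexive unweighted) (light c)))
    edge-endpoint (inj₂ refl) = NP.<⇒≱ b∨c-majority
      (NP.≤-trans (either-bound b c)
        (subst (weight b + weight R ≤_) (NP.+-identityʳ m) (NP.+-mono-≤ (light b) (NP.≤-reflexive unweighted))))

  rotate : ∀ {a b c d} → elems D ↭ a ∷ b ∷ c ∷ d ∷ [] → elems D ↭ b ∷ c ∷ d ∷ a ∷ []
  rotate {a} {b} {c} {d} D↭ = ↭-trans D↭ (↭-sym (PermP.shift a (b ∷ c ∷ d ∷ []) []))

  -- Over a closed domain forming a 4-cycle some voter is representative: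
  -- either some order is held by a majority, or the majority relation is an
  -- order R of D, which by cycle-case (applied to the rotation of the cycle
  -- starting at R) is held by a voter.
  cycle-representative : FourCycleGraph D →
    (∃ λ R → R ∈ elems D × Coincides R (Maj D P)) → ∃ λ i → Coincides (voter i) (Maj D P)
  cycle-representative (a , b , c , d , D↭ , ab , bc , cd , da , _) (R , R∈ , R≡maj)
    with FP.any? (λ i → m N.<? weight (voter i))
  ... | yes (i , heavy) = heavy⇒representative (voter i) heavy
  ... | no none-heavy with FP.any? (λ i → voter i ≟O R)
  ...   | yes (i , holds-R) = i , subst (λ Q → Coincides Q (Maj D P)) (sym holds-R) R≡maj
  ...   | no none-holds = ⊥-elim (locate (∈-resp-↭ D↭ R∈))
    where
    light : ∀ u → weight u ≤ m
    light = light-everywhere (λ i → NP.≮⇒≥ (λ heavy → none-heavy (i , heavy)))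
    case : ∀ {a′ b′ c′ d′} → elems D ↭ a′ ∷ b′ ∷ c′ ∷ d′ ∷ [] → Adjacent D b′ c′ → R ≡ a′ → ⊥
    case D↭′ edge R≡a′ = cycle-case D↭′ edge R≡a′ R∈ R≡maj (λ i e → none-holds (i , e)) light
    locate : R ∈ a ∷ b ∷ c ∷ d ∷ [] → ⊥
    locate (here R≡a) = case D↭ bc R≡a
    locate (there (here R≡b)) = case (rotate D↭) cd R≡b
    locate (there (there (here R≡c))) = case (rotate (rotate D↭)) da R≡c
    locate (there (there (there (here R≡d)))) = case (rotate (rotate (rotate D↭))) ab R≡d

closed-cycle⇒rv : ∀ {k} (D : Domain k) → Closed D → FourCycleGraph D → RepresentativeVoter D
closed-cycle⇒rv D closed cycle m P = Weights.cycle-representative D m P cycle (closed m P)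

module Spans {k : ℕ} (D : Domain k) where

  orderOf : Fin (length (elems D)) → Order k
  orderOf = L.lookup (elems D)

  inSpan : Order k → Order k → Fin (length (elems D)) → Bool
  inSpan r s j = does (between? (orderOf j) r s)

  span : Order k → Order k → ℕ
  span r s = count (length (elems D)) (inSpan r s)

  span-grows : ∀ r s r′ s′ → (∀ z → z ∈ elems D → Between z r s → Between z r′ s′) →
    ∀ {t} → t ∈ elems D → Between t r′ s′ → ¬ Between t r s → span r s < span r′ s′
  span-grows r s r′ s′ grows {t} t∈ t-in t-out =
    count-strict _ (inSpan r s) (inSpan r′ s′) inclusion j
      (dec-true (between? (orderOf j) r′ s′) (subst (λ u → Between u r′ s′) (sym t-at) t-in))
      (dec-false (between? (orderOf j) r s) (subst (λ u → ¬ Between u r s) (sym t-at) t-out))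
    where
    j : Fin (length (elems D))
    j = Any.index t∈
    t-at : orderOf j ≡ t
    t-at = sym (AnyP.lookup-index t∈)
    inclusion : ∀ i → inSpan r s i ≡ true → inSpan r′ s′ i ≡ true
    inclusion i e = dec-true (between? (orderOf i) r′ s′)
      (grows (orderOf i) (MemP.∈-lookup i) (does-true (between? (orderOf i) r s) e))

  -- If [a, b] spans a maximal number of orders of D, it contains all of D:
  -- for r ∈ D outside [a, b], middle-of-three gives a ∈ [b, r] or b ∈ [a, r],
  -- and then [r, b] respectively [a, r] would span more.
  maximal⇒spans-all : RepresentativeVoter D → ∀ {a b} → a ∈ elems D → b ∈ elems D →
    (∀ {r s} → r ∈ elems D → s ∈ elems D → span r s ≤ span a b) →
    ∀ r → r ∈ elems D → Between r a b
  maximal⇒spans-all rv {a} {b} a∈ b∈ maximal r r∈ with between? r a b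
  ... | yes r-in = r-in
  ... | no r-out with middle-of-three D rv a∈ b∈ r∈
  ...   | inj₁ a∈br = contradiction (maximal r∈ b∈) (NP.<⇒≱
            (span-grows a b r b (λ z _ z∈ab → between-sym z b r (between-trans z a b r a∈br (between-sym z a b z∈ab)))
                        r∈ (between-left r b) r-out))
  ...   | inj₂ (inj₁ b∈ar) = contradiction (maximal a∈ r∈) (NP.<⇒≱
            (span-grows a b a r (λ z _ z∈ab → between-trans z b a r b∈ar z∈ab) r∈ (between-right a r) r-out))
  ...   | inj₂ (inj₂ r-in) = contradiction r-in r-out

  spanOf : Order k × Order k → ℕ
  spanOf (r , s) = span r s

  -- A pair of orders of D spanning a maximal number of orders of D, which
  -- exists as D is finite and nonempty, spans all of D.
  endpoints : RepresentativeVoter D → ∀ {x₀} → x₀ ∈ elems D →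
    ∃₂ λ a b → a ∈ elems D × b ∈ elems D × (∀ r → r ∈ elems D → Between r a b)
  endpoints rv {x₀} x₀∈ =
    proj₁ widest , proj₂ widest , proj₁ ends∈ , proj₂ ends∈ ,
    maximal⇒spans-all rv (proj₁ ends∈) (proj₂ ends∈) maximal
    where
    pairs : List (Order k × Order k)
    pairs = L.cartesianProduct (elems D) (elems D)
    widest : Order k × Order k
    widest = argmax spanOf (x₀ , x₀) pairs
    ends∈ : proj₁ widest ∈ elems D × proj₂ widest ∈ elems D
    ends∈ = argmax-all spanOf {P = λ rs → proj₁ rs ∈ elems D × proj₂ rs ∈ elems D} (x₀∈ , x₀∈)
              (All.tabulate (MemP.∈-cartesianProduct⁻ (elems D) (elems D)))
    maximal : ∀ {r s} → r ∈ elems D → s ∈ elems D → span r s ≤ spanOf widest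
    maximal r∈ s∈ = All.lookup (f[xs]≤f[argmax] {f = spanOf} (x₀ , x₀) pairs)
                      (MemP.∈-cartesianProduct⁺ r∈ s∈)

-- If all orders of D are comparable along the ray from a (one of p, q lies
-- between a and the other), then sorting D by the span of [a, r] yields a
-- single-crossing enumeration: a smaller span means lying closer to a, and
-- orders sorted along a ray satisfy between-ray.
module RaySort {k : ℕ} (D : Domain k) (a : Order k) (a-linear : IsLinearOrder a)
  (comparable : ∀ p q → p ∈ elems D → q ∈ elems D → Between p a q ⊎ Between q a p) where
  open Spans D

  key : Order k → ℕ
  key r = span a r

  byKey : DecTotalOrder _ _ _
  byKey = On.decTotalOrder NP.≤-decTotalOrder key

  open Data.List.Sort byKey using (sort; sort-↭; sort-↗)

  key-≤⇒between : ∀ {p q} → p ∈ elems D → q ∈ elems D → key p ≤ key q → Between p a q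
  key-≤⇒between {p} {q} p∈ q∈ key≤ with between? p a q
  ... | yes p-in = p-in
  ... | no p-out with comparable p q p∈ q∈
  ...   | inj₁ p-in = contradiction p-in p-out
  ...   | inj₂ q∈ap = contradiction key≤ (NP.<⇒≱
            (span-grows a q a p (λ z _ z∈aq → between-trans z q a p q∈ap z∈aq) p∈ (between-right a p) p-out))

  single-crossing : SingleCrossing D
  single-crossing = sorted , sort-↭ (elems D) , λ x y _ → interval x y , interval y x
    where
    sorted : List (Order k)
    sorted = sort (elems D)
    order : Fin (length sorted) → Order k
    order = L.lookup sorted
    member : ∀ j → order j ∈ elems D
    member j = ∈-resp-↭ (sort-↭ (elems D)) (MemP.∈-lookup j)
    ordered : ∀ {i j} → toℕ i ≤ toℕ j → Between (order i) a (order j)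
    ordered {i} {j} i≤j = key-≤⇒between (member i) (member j)
      (SortedP.lookup-mono-≤ (DecTotalOrder.totalOrder byKey) (sort-↗ (elems D)) i≤j)
    interval : ∀ x y → IsInterval (λ j → x ≻[ order j ] y)
    interval x y i j l i≤l l≤j =
      between-ray a (order i) (order l) (order j) a-linear
        (All.lookup (linear D) (member l)) (ordered i≤l) (ordered l≤j) x y

module Rectangle {k : ℕ} (D : Domain k) (rv : RepresentativeVoter D) {a b p q : Order k}
  (a∈ : a ∈ elems D) (b∈ : b ∈ elems D) (p∈ : p ∈ elems D) (q∈ : q ∈ elems D)
  (spans : ∀ r → r ∈ elems D → Between r a b)
  (p-off : ¬ Between p a q) (q-off : ¬ Between q a p) where

  lin : ∀ {r} → r ∈ elems D → IsLinearOrder r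
  lin = All.lookup (linear D)

  -- The corners lie between their neighbours: p, q ∈ [a, b] by assumption,
  -- and a, b ∈ [p, q] by middle-of-three.

  p∈ab : Between p a b
  p∈ab = spans p p∈

  q∈ab : Between q a b
  q∈ab = spans q q∈

  a∈pq : Between a p q
  a∈pq with middle-of-three D rv a∈ p∈ q∈
  ... | inj₁ a-mid = a-mid
  ... | inj₂ (inj₁ p-mid) = contradiction p-mid p-off
  ... | inj₂ (inj₂ q-mid) = contradiction q-mid q-off

  b∈pq : Between b p q
  b∈pq with middle-of-three D rv b∈ p∈ q∈
  ... | inj₁ b-mid = b-mid
  ... | inj₂ (inj₁ p∈bq) = contradiction (between-shrink a b p q (lin b∈) (lin q∈) p∈bq q∈ab) q-off
  ... | inj₂ (inj₂ q∈bp) = contradiction (between-shrink a b q p (lin b∈) (lin p∈) q∈bp p∈ab) p-off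

  same : ∀ {x y z} → x ∈ elems D → y ∈ elems D → z ∈ elems D →
    Between x y z → Between y x z → x ≡ y
  same {x} {y} {z} x∈ y∈ z∈ = between-antisym x y z (lin x∈) (lin y∈) (lin z∈)

  p≢a : p ≢ a
  p≢a refl = p-off (between-left p q)
  q≢a : q ≢ a
  q≢a refl = q-off (between-left q p)
  p≢q : p ≢ q
  p≢q refl = p-off (between-right a p)
  p≢b : p ≢ b
  p≢b refl = q-off (between-shrink a p p q (lin p∈) (lin q∈) (between-left p q) q∈ab)
  q≢b : q ≢ b
  q≢b refl = p-off (between-shrink a q q p (lin q∈) (lin p∈) (between-left q p) p∈ab)
  a≢b : a ≢ b
  a≢b refl = p≢a (same p∈ a∈ a∈ p∈ab (between-right p a))

  edge-cases : ∀ x x′ y y′ {r} → x ∈ elems D → y ∈ elems D → r ∈ elems D →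
    Between r x x′ → Between x′ y y′ →
    Between r x y ⊎ (Between r x y′ ⊎ Between r x′ y)
  edge-cases x x′ y y′ {r} x∈ y∈ r∈ r∈xx′ x′∈yy′ with middle-of-three D rv x∈ y∈ r∈
  ... | inj₁ x∈yr = inj₂ (inj₁ (between-swap-end x x′ y y′ r (lin y∈) (lin r∈) r∈xx′ x′∈yy′ x∈yr))
  ... | inj₂ (inj₁ y∈xr) = inj₂ (inj₂ (between-far-end x x′ y r (lin x∈) (lin r∈) r∈xx′ y∈xr))
  ... | inj₂ (inj₂ r∈xy) = inj₁ r∈xy

  Corner : Order k → Set
  Corner r = r ∈ a ∷ p ∷ b ∷ q ∷ []

  -- Every order of D is a corner: locate it in two edge intervals.
  module Classify {r : Order k} (r∈ : r ∈ elems D) where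
    lr : IsLinearOrder r
    lr = lin r∈
    r∈ab : Between r a b
    r∈ab = spans r r∈
    r∈ba : Between r b a
    r∈ba = between-sym r a b r∈ab

    at-a : Between r a p → Between r a q → Corner r
    at-a r∈ap r∈aq = here (between-corner a p q r (lin a∈) (lin p∈) (lin q∈) lr r∈ap r∈aq a∈pq)
    at-p : Between r a p → Between r b p → Corner r
    at-p r∈ap r∈bp = there (here (between-corner p a b r (lin p∈) (lin a∈) (lin b∈) lr
      (between-sym r a p r∈ap) (between-sym r b p r∈bp) p∈ab))
    at-b : Between r b p → Between r b q → Corner r
    at-b r∈bp r∈bq = there (there (here (between-corner b p q r (lin b∈) (lin p∈) (lin q∈) lr r∈bp r∈bq b∈pq)))
    at-q : Between r a q → Between r b q → Corner r
    at-q r∈aq r∈bq = there (there (there (here (between-corner q a b r (lin q∈) (lin a∈) (lin b∈) lr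
      (between-sym r a q r∈aq) (between-sym r b q r∈bq) q∈ab))))
    not-ap-bq : Between r a p → Between r b q → ⊥
    not-ap-bq r∈ap r∈bq =
      p≢b (between-crossed a b p q r (lin a∈) (lin b∈) (lin p∈) (lin q∈) r∈ap r∈bq b∈pq p∈ab r∈ab)
    not-aq-bp : Between r a q → Between r b p → ⊥
    not-aq-bp r∈aq r∈bp =
      q≢b (between-crossed a b q p r (lin a∈) (lin b∈) (lin q∈) (lin p∈) r∈aq r∈bp
        (between-sym b p q b∈pq) q∈ab r∈ab)

    corner : Corner r
    corner with edge-cases a b p q a∈ p∈ r∈ r∈ab b∈pq
    ... | inj₁ r∈ap with edge-cases b a q p b∈ q∈ r∈ r∈ba (between-sym a p q a∈pq)
    ...   | inj₁ r∈bq = ⊥-elim (not-ap-bq r∈ap r∈bq)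
    ...   | inj₂ (inj₁ r∈bp) = at-p r∈ap r∈bp
    ...   | inj₂ (inj₂ r∈aq) = at-a r∈ap r∈aq
    corner | inj₂ (inj₁ r∈aq) with edge-cases b a p q b∈ p∈ r∈ r∈ba a∈pq
    ...   | inj₁ r∈bp = ⊥-elim (not-aq-bp r∈aq r∈bp)
    ...   | inj₂ (inj₁ r∈bq) = at-q r∈aq r∈bq
    ...   | inj₂ (inj₂ r∈ap) = at-a r∈ap r∈aq
    corner | inj₂ (inj₂ r∈bp) with edge-cases a b q p a∈ q∈ r∈ r∈ab (between-sym b p q b∈pq)
    ...   | inj₁ r∈aq = ⊥-elim (not-aq-bp r∈aq r∈bp)
    ...   | inj₂ (inj₁ r∈ap) = at-p r∈ap r∈bp
    ...   | inj₂ (inj₂ r∈bq) = at-b r∈bp r∈bq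

  corners-unique : Unique (a ∷ p ∷ b ∷ q ∷ [])
  corners-unique = (≢-sym p≢a All.∷ a≢b All.∷ ≢-sym q≢a All.∷ All.[])
            AllPairs.∷ (p≢b All.∷ p≢q All.∷ All.[])
            AllPairs.∷ (≢-sym q≢b All.∷ All.[])
            AllPairs.∷ All.[]
            AllPairs.∷ AllPairs.[]
    where
    ≢-sym : ∀ {u v : Order k} → u ≢ v → v ≢ u
    ≢-sym u≢v v≡u = u≢v (sym v≡u)

  corner∈ : ∀ {r} → Corner r → r ∈ elems D
  corner∈ (here refl) = a∈
  corner∈ (there (here refl)) = p∈
  corner∈ (there (there (here refl))) = b∈
  corner∈ (there (there (there (here refl)))) = q∈

  D↭corners : elems D ↭ a ∷ p ∷ b ∷ q ∷ []
  D↭corners = ∼bag⇒↭ (unique∧set⇒bag (unique D) corners-unique (mk⇔ Classify.corner corner∈))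

  adjacent : ∀ {R R′} → R ≢ R′ → R ∈ elems D → R′ ∈ elems D →
    (∀ {Q} → Corner Q → Between Q R R′ → Q ≡ R ⊎ Q ≡ R′) → Adjacent D R R′
  adjacent R≢R′ R∈ R′∈ only = R≢R′ , R∈ , R′∈ , λ Q Q∈ Q-in → only (Classify.corner Q∈) Q-in

  edge-ap : Adjacent D a p
  edge-ap = adjacent (λ a≡p → p≢a (sym a≡p)) a∈ p∈ λ where
    (here refl) _ → inj₁ refl
    (there (here refl)) _ → inj₂ refl
    (there (there (here refl))) b∈ap →
      ⊥-elim (p≢b (same p∈ b∈ a∈ (between-sym p a b p∈ab) (between-sym b a p b∈ap)))
    (there (there (there (here refl)))) q∈ap → ⊥-elim (q-off q∈ap)

  edge-pb : Adjacent D p b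
  edge-pb = adjacent p≢b p∈ b∈ λ where
    (here refl) a∈pb → ⊥-elim (p≢a (sym (same a∈ p∈ b∈ a∈pb p∈ab)))
    (there (here refl)) _ → inj₁ refl
    (there (there (here refl))) _ → inj₂ refl
    (there (there (there (here refl)))) q∈pb →
      ⊥-elim (q≢b (same q∈ b∈ p∈ (between-sym q p b q∈pb) (between-sym b p q b∈pq)))

  edge-bq : Adjacent D b q
  edge-bq = adjacent (λ b≡q → q≢b (sym b≡q)) b∈ q∈ λ where
    (here refl) a∈bq → ⊥-elim (q≢a (sym (same a∈ q∈ b∈ (between-sym a b q a∈bq) q∈ab)))
    (there (here refl)) p∈bq → ⊥-elim (p≢b (same p∈ b∈ q∈ p∈bq b∈pq))
    (there (there (here refl))) _ → inj₁ refl
    (there (there (there (here refl)))) _ → inj₂ refl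

  edge-qa : Adjacent D q a
  edge-qa = adjacent q≢a q∈ a∈ λ where
    (here refl) _ → inj₂ refl
    (there (here refl)) p∈qa → ⊥-elim (p-off (between-sym p q a p∈qa))
    (there (there (here refl))) b∈qa →
      ⊥-elim (q≢b (sym (same b∈ q∈ a∈ b∈qa (between-sym q a b q∈ab))))
    (there (there (there (here refl)))) _ → inj₁ refl

  -- Opposite corners are not adjacent: p lies strictly between a and b,
  -- and a strictly between p and q.
  not-ab : ¬ Adjacent D a b
  not-ab (_ , _ , _ , only) = [ p≢a , p≢b ]′ (only p p∈ p∈ab)

  not-pq : ¬ Adjacent D p q
  not-pq (_ , _ , _ , only) = [ (λ a≡p → p≢a (sym a≡p)) , (λ a≡q → q≢a (sym a≡q)) ]′ (only a a∈ a∈pq)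

  four-cycle : FourCycleGraph D
  four-cycle = a , p , b , q , D↭corners , edge-ap , edge-pb , edge-bq , edge-qa , not-ab , not-pq

  four-elements : length (elems D) ≡ 4
  four-elements = PermP.↭-length D↭corners

all-pairs-or-counterexample : ∀ {A : Set} (R : A → A → Set) → (∀ x y → Dec (R x y)) → ∀ xs →
  (∀ {x y} → x ∈ xs → y ∈ xs → R x y) ⊎ (∃₂ λ x y → x ∈ xs × y ∈ xs × ¬ R x y)
all-pairs-or-counterexample R R? xs with All.all? row? xs
  where
  row? : ∀ x → Dec (All.All (R x) xs)
  row? x = All.all? (R? x) xs
... | yes all = inj₁ λ x∈ y∈ → All.lookup (All.lookup all x∈) y∈
... | no not-all =
  let (x , x∈ , bad-row) = find (¬All⇒Any¬ (λ x → All.all? (R? x) xs) xs not-all)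
      (y , y∈ , ¬Rxy) = find (¬All⇒Any¬ (R? x) xs bad-row)
  in inj₂ (x , y , x∈ , y∈ , ¬Rxy)

empty⇒sc : ∀ {k} (D : Domain k) → elems D ≡ [] → SingleCrossing D
empty⇒sc D empty = [] , subst ([] ↭_) (sym empty) ↭-refl , λ _ _ _ → (λ ()) , (λ ())

empty-or-member : ∀ {A : Set} (xs : List A) → xs ≡ [] ⊎ ∃ (_∈ xs)
empty-or-member [] = inj₁ refl
empty-or-member (x ∷ _) = inj₂ (x , here refl)

-- If all orders of D are
-- comparable along the ray from a, sorting along the ray makes D
-- single-crossing; otherwise an incomparable pair p, q forms a rectangle
-- with a and b.
from-endpoints : ∀ {k} (D : Domain k) → RepresentativeVoter D → ∀ {a b} →
  a ∈ elems D → b ∈ elems D → (∀ r → r ∈ elems D → Between r a b) →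
  SingleCrossing D ⊎ (Closed D × CondorcetDomain D × length (elems D) ≡ 4 × FourCycleGraph D)
from-endpoints D rv {a} {b} a∈ b∈ spans
  with all-pairs-or-counterexample (λ p q → Between p a q ⊎ Between q a p)
         (λ p q → between? p a q ⊎-dec between? q a p) (elems D)
... | inj₁ comparable =
  inj₁ (RaySort.single-crossing D a (All.lookup (linear D) a∈) (λ _ _ → comparable))
... | inj₂ (p , q , p∈ , q∈ , incomparable) =
  inj₂ (rv⇒closed D rv , rv⇒condorcet D rv , R.four-elements , R.four-cycle)
  where
  module R = Rectangle D rv a∈ b∈ p∈ q∈ spans (λ p-in → incomparable (inj₁ p-in))
                                                (λ q-in → incomparable (inj₂ q-in))

rv⇒sc⊎cycle : ∀ {k} (D : Domain k) → RepresentativeVoter D →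
  SingleCrossing D ⊎ (Closed D × CondorcetDomain D × length (elems D) ≡ 4 × FourCycleGraph D)
rv⇒sc⊎cycle D rv with empty-or-member (elems D)
... | inj₁ empty = inj₁ (empty⇒sc D empty)
... | inj₂ (x₀ , x₀∈) =
  let (a , b , a∈ , b∈ , spans) = Spans.endpoints D rv x₀∈
  in from-endpoints D rv a∈ b∈ spans

theorem6 : (k : ℕ) (D : Domain k) →
  RepresentativeVoter D ⇔
    (SingleCrossing D ⊎
      (Closed D × CondorcetDomain D × length (elems D) ≡ 4 × FourCycleGraph D))
theorem6 k D = mk⇔ (rv⇒sc⊎cycle D)
  [ sc⇒rv D , (λ (closed , _ , _ , cycle) → closed-cycle⇒rv D closed cycle) ]′
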